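{- For all positive integers $d$ and $n$, $\mathrm{Det}(\vec{\mathcal B}(d,n))=\left\lceil\frac{d-1}{n}\right\rceil$.
   Context: $\mathcal A_d=\{0,1,\dots,d-1\}$. The directed de Bruijn graph $\vec{\mathcal B}(d,n)$ has vertex set $\mathcal A_d^n$ (strings of length $n$ over $\mathcal A_d$) and an arc from $x_1\cdots x_n$ to $y_1\cdots y_n$ iff $x_2\cdots x_n=y_1\cdots y_{n-1}$. An automorphism of a directed graph is a permutation $\pi$ of the vertices such that $(u,v)$ is an arc iff $(\pi(u),\pi(v))$ is an arc. A determining set of $G$ is a vertex set $S$ such that the only automorphism of $G$ fixing every vertex of $S$ is the identity; $\mathrm{Det}(G)$ is the minimum size of a determining set. -}

module Defs where

open import Data.Nat using (ℕ; zero; suc; _+_; _∸_; _≤_; NonZero)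
open import Data.Nat.DivMod using (_/_)
open import Data.Fin using (Fin)
open import Data.Vec using (Vec; tail; init)
open import Data.List using (List; length)
open import Data.List.Membership.Propositional using (_∈_)
open import Data.Product using (_×_; Σ)
open import Data.Unit using (⊤)
open import Function.Bundles using (_↔_; Inverse; _⇔_)
open import Relation.Binary.PropositionalEquality using (_≡_)

Vertex : ℕ → ℕ → Set
Vertex d n = Vec (Fin d) n

Arc : (d n : ℕ) → Vertex d n → Vertex d n → Set
Arc d zero    x y = ⊤
Arc d (suc m) x y = tail x ≡ init y

IsAutomorphism : (d n : ℕ) → (Vertex d n ↔ Vertex d n) → Set
IsAutomorphism d n π =
  ∀ u v → Arc d n u v ⇔ Arc d n (Inverse.to π u) (Inverse.to π v)

IsDeterminingSet : (d n : ℕ) → List (Vertex d n) → Set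
IsDeterminingSet d n S =
  (π : Vertex d n ↔ Vertex d n) → IsAutomorphism d n π →
  (∀ s → s ∈ S → Inverse.to π s ≡ s) → ∀ v → Inverse.to π v ≡ v

-- Det(B(d,n)) = k: k is the minimum size of a determining set.
-- (Sets are represented by lists; minimising over lists equals minimising
--  over sets since duplicates only increase the length.)
DetIs : (d n k : ℕ) → Set
DetIs d n k =
  Σ (List (Vertex d n)) (λ S → IsDeterminingSet d n S × length S ≡ k)
  × (∀ S → IsDeterminingSet d n S → k ≤ length S)

⌈_/_⌉ : ℕ → (b : ℕ) → .{{NonZero b}} → ℕ
⌈ a / b ⌉ = (a + (b ∸ 1)) / b

module Submission where

-- The heart of the proof is that every automorphism of the de Bruijn graph is
-- induced by a permutation σ of the alphabet acting letter by letter.  In fact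
-- every arc-preserving self-map f of the words of length m+1 is letterwise:
-- the map  w ↦ tail (f (head w ∷ w))  is an arc-preserving map on words one
-- letter shorter that commutes with 'init' and 'tail' (the de Bruijn graph of
-- length m+1 is the line graph of the one of length m), so by induction on m
-- the i-th letter of f z depends only on the i-th letter of z; and constant
-- words (the loops) are sent to constant words.
--
-- Consequently a set S of words is determining exactly when at most one letter
-- of the alphabet does not occur in S: if two letters a ≠ b are missing, the
-- transposition (a b) fixes S but not aaa…a; if only e is missing, σ fixes all
-- letters but e and, being injective, also e.  Counting letters (each word has
-- n of them) gives the lower bound d-1 ≤ n·|S|, and cutting the letters
-- 0, …, d-2 into ⌈(d-1)/n⌉ blocks of length n gives a matching determining set.

open import Defs
open import Data.Nat using (ℕ; _∸_; NonZero)
open import Data.Nat.Base using (zero; suc; _+_; _*_; _≤_; _<_; s≤s; s≤s⁻¹)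
import Data.Nat.Properties as ℕP
open import Data.Nat.DivMod
  using (DivMod; _/_; _%_; _mod_; _divMod_; m<n⇒m%n≡m; m<n*o⇒m/o<n; /-monoˡ-≤; m/n≡1+[m∸n]/n)
open import Data.Fin.Base using (Fin; toℕ; fromℕ; inject₁)
import Data.Fin.Properties as FinP
open import Data.Fin.Permutation using (transpose)
import Data.Fin.Permutation.Components as Transposition
open import Data.Vec.Base using (Vec; []; _∷_; head; tail; init; lookup; replicate; tabulate; map; _∷ʳ_; toList)
open import Data.Vec.Properties
  using (tabulate∘lookup; tabulate-cong; lookup∘tabulate; lookup-replicate; lookup-map; map-∘; map-cong; map-id; init-∷ʳ; length-toList)
open import Data.Vec.Membership.Propositional.Properties using (∈-lookup; ∈-toList⁺)
open import Data.List.Base as List using (List; length; upTo; _++_)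
import Data.List.Properties as ListP
import Data.List.Membership.DecPropositional as DecMembership
open import Data.List.Membership.Propositional using (_∈_; _∉_)
import Data.List.Membership.Propositional.Properties as ∈P
open import Data.List.Relation.Unary.Any as Any using (here; there)
import Data.List.Relation.Unary.Any.Properties as AnyP
open import Data.Sum using (inj₁; inj₂)
open import Data.Product using (_×_; ∃; ∃₂; _,_)
open import Data.Empty using (⊥; ⊥-elim)
open import Function.Base using (id; _∘_)
open import Function.Bundles using (_↔_; Inverse; Injection; Equivalence; mk↔ₛ′; mk⇔)
open import Function.Properties.Inverse using (↔⇒↣)
open import Relation.Nullary using (¬_; yes; no)
open import Relation.Nullary.Decidable using (dec-true; dec-false)
open import Relation.Binary.PropositionalEquality
open ≡-Reasoning

lookup-extensionality : ∀ {A : Set} {k} (u v : Vec A k) →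
  (∀ i → lookup u i ≡ lookup v i) → u ≡ v
lookup-extensionality u v same = begin
  u                   ≡⟨ tabulate∘lookup u ⟨
  tabulate (lookup u) ≡⟨ tabulate-cong same ⟩
  tabulate (lookup v) ≡⟨ tabulate∘lookup v ⟩
  v                   ∎

lookup-init : ∀ {A : Set} {m} (v : Vec A (suc m)) (i : Fin m) →
  lookup (init v) i ≡ lookup v (inject₁ i)
lookup-init (x ∷ y ∷ v) Fin.zero    = refl
lookup-init (x ∷ y ∷ v) (Fin.suc i) = lookup-init (y ∷ v) i

lookup-tail : ∀ {A : Set} {m} (v : Vec A (suc m)) (i : Fin m) →
  lookup (tail v) i ≡ lookup v (Fin.suc i)
lookup-tail (x ∷ v) i = refl

tail-init : ∀ {A : Set} {m} (v : Vec A (2 + m)) → tail (init v) ≡ init (tail v)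
tail-init (x ∷ v) = refl

init-map : ∀ {A B : Set} {m} (f : A → B) (v : Vec A (suc m)) → init (map f v) ≡ map f (init v)
init-map f (x ∷ [])    = refl
init-map f (x ∷ y ∷ v) = cong (f x ∷_) (init-map f (y ∷ v))

replicate-loop : ∀ {A : Set} m (c : A) → tail (replicate (suc m) c) ≡ init (replicate (suc m) c)
replicate-loop zero    c = refl
replicate-loop (suc m) c = cong (c ∷_) (replicate-loop m c)

loop⇒constant : ∀ {A : Set} {m} (v : Vec A (suc m)) → tail v ≡ init v → v ≡ replicate (suc m) (head v)
loop⇒constant (x ∷ [])    _    = refl
loop⇒constant (x ∷ y ∷ v) loop =
  cong (x ∷_) (trans (loop⇒constant (y ∷ v) (cong tail loop)) (cong (replicate _) (cong head loop)))

module ArcPreservingMaps {A : Set} where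

  ArcPreserving : ∀ {m} → (Vec A (suc m) → Vec A (suc m)) → Set
  ArcPreserving f = ∀ z y → tail z ≡ init y → tail (f z) ≡ init (f y)

  Positional : ∀ {m} → (Vec A m → Vec A m) → Set
  Positional f = ∀ i z z' → lookup z i ≡ lookup z' i → lookup (f z) i ≡ lookup (f z') i

  -- Words of length m+2 are the arcs of the de Bruijn graph on words of
  -- length m+1; an arc-preserving f on them induces this map on the vertices
  -- (send w to the target of the image of an arc leaving w).
  shrink : ∀ {m} → (Vec A (2 + m) → Vec A (2 + m)) → Vec A (suc m) → Vec A (suc m)
  shrink f w = tail (f (head w ∷ w))

  module _ {m} (f : Vec A (2 + m) → Vec A (2 + m)) (pres : ArcPreserving f) where

    init-shrink : ∀ z → init (f z) ≡ shrink f (init z)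
    init-shrink z = sym (pres (head (init z) ∷ init z) z refl)

    -- z and (head (tail z) ∷ tail z) both have an arc to (tail z ∷ʳ head (tail z)).
    tail-shrink : ∀ z → tail (f z) ≡ shrink f (tail z)
    tail-shrink z = trans (pres z y z→y) (sym (pres (a ∷ tail z) y z→y))
      where
        a : A
        a = head (tail z)
        y : Vec A (2 + m)
        y = tail z ∷ʳ a
        z→y : tail z ≡ init y
        z→y = sym (init-∷ʳ a (tail z))

    -- An arc w → y glues to the word u = head w ∷ y with init u = w and tail u = y.
    shrink-preserving : ArcPreserving (shrink f)
    shrink-preserving w@(x ∷ _) y w→y = begin
      tail (shrink f w)        ≡⟨ cong (tail ∘ shrink f) (cong (x ∷_) w→y) ⟩
      tail (shrink f (init u)) ≡⟨ cong tail (init-shrink u) ⟨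
      tail (init (f u))        ≡⟨ tail-init (f u) ⟩
      init (tail (f u))        ≡⟨ cong init (tail-shrink u) ⟩
      init (shrink f y)        ∎
      where
        u : Vec A (2 + m)
        u = x ∷ y

  positional-through : ∀ {k l} {f : Vec A k → Vec A k} {g : Vec A l → Vec A l}
    (r : Vec A k → Vec A l) (pos : Fin l → Fin k) →
    (∀ v j → lookup (r v) j ≡ lookup v (pos j)) →
    (∀ z → r (f z) ≡ g (r z)) → Positional g →
    ∀ j z z' → lookup z (pos j) ≡ lookup z' (pos j) → lookup (f z) (pos j) ≡ lookup (f z') (pos j)
  positional-through {f = f} {g} r pos lookup-r commute g-pos j z z' same = begin
    lookup (f z) (pos j)  ≡⟨ lookup-r (f z) j ⟨
    lookup (r (f z)) j    ≡⟨ cong (λ v → lookup v j) (commute z) ⟩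
    lookup (g (r z)) j    ≡⟨ g-pos j (r z) (r z') (trans (lookup-r z j) (trans same (sym (lookup-r z' j)))) ⟩
    lookup (g (r z')) j   ≡⟨ cong (λ v → lookup v j) (commute z') ⟨
    lookup (r (f z')) j   ≡⟨ lookup-r (f z') j ⟩
    lookup (f z') (pos j) ∎

  -- Induction on the word length: position 0 is seen through 'init',
  -- positions j+1 through 'tail'.
  arcPreserving⇒positional : ∀ {m} (f : Vec A (suc m) → Vec A (suc m)) →
    ArcPreserving f → Positional f
  arcPreserving⇒positional {zero} f _ Fin.zero (x ∷ []) (.x ∷ []) refl = refl
  arcPreserving⇒positional {suc m} f pres Fin.zero =
    positional-through {f = f} {shrink f} init inject₁ lookup-init (init-shrink f pres)
      (arcPreserving⇒positional (shrink f) (shrink-preserving f pres)) Fin.zero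
  arcPreserving⇒positional {suc m} f pres (Fin.suc j) =
    positional-through {f = f} {shrink f} tail Fin.suc lookup-tail (tail-shrink f pres)
      (arcPreserving⇒positional (shrink f) (shrink-preserving f pres)) j

  letterMap : ∀ {m} → (Vec A (suc m) → Vec A (suc m)) → A → A
  letterMap f c = head (f (replicate _ c))

  module _ {m} (f : Vec A (suc m) → Vec A (suc m)) (pres : ArcPreserving f) where

    -- Loops go to loops, so constant words go to constant words.
    constant↦constant : ∀ c → f (replicate _ c) ≡ replicate _ (letterMap f c)
    constant↦constant c = loop⇒constant (f (replicate _ c)) (pres _ _ (replicate-loop m c))

    -- Compare z with the constant word on its i-th letter.
    arcPreserving⇒letterwise : ∀ z → f z ≡ map (letterMap f) z
    arcPreserving⇒letterwise z = lookup-extensionality _ _ λ i →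
      let c = lookup z i in begin
      lookup (f z) i                   ≡⟨ arcPreserving⇒positional f pres i z (replicate _ c)
                                            (sym (lookup-replicate i c)) ⟩
      lookup (f (replicate _ c)) i     ≡⟨ cong (λ v → lookup v i) (constant↦constant c) ⟩
      lookup (replicate _ (letterMap f c)) i ≡⟨ lookup-replicate i _ ⟩
      letterMap f c                    ≡⟨ lookup-map i (letterMap f) z ⟨
      lookup (map (letterMap f) z) i   ∎

open ArcPreservingMaps

map-preserves-arcs : ∀ {A B : Set} {m} (σ : A → B) (u v : Vec A (suc m)) →
  tail u ≡ init v → tail (map σ u) ≡ init (map σ v)
map-preserves-arcs σ (x ∷ u) v u→v = trans (cong (map σ) u→v) (sym (init-map σ v))

map-inverse : ∀ {A B : Set} {k} {σ : A → B} {τ : B → A} →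
  (∀ x → τ (σ x) ≡ x) → ∀ (v : Vec A k) → map τ (map σ v) ≡ v
map-inverse {σ = σ} {τ} τσ v = trans (sym (map-∘ τ σ v)) (trans (map-cong τσ v) (map-id v))

map-fixed⇒fixes : ∀ {A : Set} {k} (σ : A → A) (s : Vec A k) →
  map σ s ≡ s → ∀ x → x ∈ toList s → σ x ≡ x
map-fixed⇒fixes σ (y ∷ s) fixed x (here refl) = cong head fixed
map-fixed⇒fixes σ (y ∷ s) fixed x (there x∈s) = map-fixed⇒fixes σ s (cong tail fixed) x x∈s

fixes⇒map-fixed : ∀ {A : Set} {k} (σ : A → A) (s : Vec A k) →
  (∀ x → x ∈ toList s → σ x ≡ x) → map σ s ≡ s
fixes⇒map-fixed σ []      _     = refl
fixes⇒map-fixed σ (y ∷ s) fixes = cong₂ _∷_ (fixes y (here refl)) (fixes⇒map-fixed σ s (λ x → fixes x ∘ there))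

induced : ∀ {d n} → (Fin d ↔ Fin d) → Vertex d n ↔ Vertex d n
induced σ = mk↔ₛ′ (map (Inverse.to σ)) (map (Inverse.from σ))
  (map-inverse (Inverse.strictlyInverseˡ σ)) (map-inverse (Inverse.strictlyInverseʳ σ))

-- An arc u → v is reflected by applying the inverse letter permutation.
induced-automorphism : ∀ {d m} (σ : Fin d ↔ Fin d) → IsAutomorphism d (suc m) (induced σ)
induced-automorphism {d} σ u v = mk⇔ (map-preserves-arcs to u v) reflect
  where
    to from : Fin d → Fin d
    to = Inverse.to σ
    from = Inverse.from σ
    reflect : tail (map to u) ≡ init (map to v) → tail u ≡ init v
    reflect arc = subst₂ (λ p q → tail p ≡ init q)
      (map-inverse (Inverse.strictlyInverseʳ σ) u) (map-inverse (Inverse.strictlyInverseʳ σ) v)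
      (map-preserves-arcs from (map to u) (map to v) arc)

module Automorphism {d m} (π : Vertex d (suc m) ↔ Vertex d (suc m)) (aut : IsAutomorphism d (suc m) π) where

  pres : ArcPreserving (Inverse.to π)
  pres z y = Equivalence.to (aut z y)

  σ : Fin d → Fin d
  σ = letterMap (Inverse.to π)

  letterwise : ∀ z → Inverse.to π z ≡ map σ z
  letterwise = arcPreserving⇒letterwise (Inverse.to π) pres

  -- σ is injective because π is, and π sends c…c to σ(c)…σ(c).
  σ-injective : ∀ c c' → σ c ≡ σ c' → c ≡ c'
  σ-injective c c' σc≡σc' = cong head (Injection.injective (↔⇒↣ π) (begin
    Inverse.to π (replicate _ c)  ≡⟨ constant↦constant (Inverse.to π) pres c ⟩
    replicate _ (σ c)             ≡⟨ cong (replicate _) σc≡σc' ⟩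
    replicate _ (σ c')            ≡⟨ constant↦constant (Inverse.to π) pres c' ⟨
    Inverse.to π (replicate _ c') ∎))

letters : ∀ {A : Set} {k} → List (Vec A k) → List A
letters List.[]       = List.[]
letters (s List.∷ T) = toList s ++ letters T

length-letters : ∀ {A : Set} {k} (T : List (Vec A k)) → length (letters T) ≡ length T * k
length-letters List.[]       = refl
length-letters (s List.∷ T) =
  trans (ListP.length-++ (toList s)) (cong₂ _+_ (length-toList s) (length-letters T))

∈-letters⁺ : ∀ {A : Set} {k} {T : List (Vec A k)} {s x} → s ∈ T → x ∈ toList s → x ∈ letters T
∈-letters⁺ {T = s List.∷ T} (here refl) x∈s = ∈P.∈-++⁺ˡ x∈s
∈-letters⁺ {T = s List.∷ T} (there s∈T) x∈s = ∈P.∈-++⁺ʳ (toList s) (∈-letters⁺ s∈T x∈s)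

∈-letters⁻ : ∀ {A : Set} {k} (T : List (Vec A k)) {x} → x ∈ letters T → ∃ λ s → s ∈ T × x ∈ toList s
∈-letters⁻ (s List.∷ T) x∈ with ∈P.∈-++⁻ (toList s) x∈
... | inj₁ x∈s = s , here refl , x∈s
... | inj₂ x∈T with ∈-letters⁻ T x∈T
...   | s' , s'∈T , x∈s' = s' , there s'∈T , x∈s'

fixes-all-but-one⇒fixes : ∀ {d} (σ : Fin d → Fin d) → (∀ c c' → σ c ≡ σ c' → c ≡ c') →
  (e : Fin d) → (∀ c → c ≢ e → σ c ≡ c) → σ e ≡ e
fixes-all-but-one⇒fixes σ injective e fixes with σ e FinP.≟ e
... | yes σe≡e = σe≡e
... | no  σe≢e = ⊥-elim (σe≢e (injective (σ e) e (fixes (σ e) σe≢e)))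

-- If all letters but one occur in S, then S is determining: an automorphism
-- fixing S has a letter permutation fixing those letters, hence every letter.
all-but-one-letter⇒determining : ∀ {d m} (S : List (Vertex d (suc m))) (e : Fin d) →
  (∀ c → c ≢ e → c ∈ letters S) → IsDeterminingSet d (suc m) S
all-but-one-letter⇒determining S e occurs π aut fixes-S v = begin
  Inverse.to π v ≡⟨ letterwise v ⟩
  map σ v        ≡⟨ map-cong σ-fixes v ⟩
  map id v       ≡⟨ map-id v ⟩
  v              ∎
  where
    open Automorphism π aut
    σ-fixes-occurring : ∀ c → c ≢ e → σ c ≡ c
    σ-fixes-occurring c c≢e with ∈-letters⁻ S (occurs c c≢e)
    ... | s , s∈S , c∈s = map-fixed⇒fixes σ s (trans (sym (letterwise s)) (fixes-S s s∈S)) c c∈s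
    σ-fixes : ∀ c → σ c ≡ c
    σ-fixes c with c FinP.≟ e
    ... | yes refl = fixes-all-but-one⇒fixes σ σ-injective e σ-fixes-occurring
    ... | no  c≢e  = σ-fixes-occurring c c≢e

transpose-left : ∀ {d} (a b : Fin d) → Transposition.transpose a b a ≡ b
transpose-left a b rewrite dec-true (a FinP.≟ a) refl = refl

transpose-other : ∀ {d} (a b x : Fin d) → x ≢ a → x ≢ b → Transposition.transpose a b x ≡ x
transpose-other a b x x≢a x≢b rewrite dec-false (x FinP.≟ a) x≢a | dec-false (x FinP.≟ b) x≢b = refl

-- If two letters a ≠ b are missing from T, the transposition (a b) induces an
-- automorphism fixing T but moving the constant word a…a.
determining⇒no-two-missing : ∀ {d m} (T : List (Vertex d (suc m))) → IsDeterminingSet d (suc m) T →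
  ∀ a b → a ≢ b → a ∉ letters T → b ∉ letters T → ⊥
determining⇒no-two-missing {d} {m} T determining a b a≢b a∉T b∉T = a≢b (begin
  a                               ≡⟨ cong head (determining τ (induced-automorphism (transpose a b)) fixes-T (replicate _ a)) ⟨
  Transposition.transpose a b a   ≡⟨ transpose-left a b ⟩
  b                               ∎)
  where
    τ : Vertex d (suc m) ↔ Vertex d (suc m)
    τ = induced (transpose a b)
    fixes-T : ∀ s → s ∈ T → Inverse.to τ s ≡ s
    fixes-T s s∈T = fixes⇒map-fixed _ s λ x x∈s →
      let x∈T = ∈-letters⁺ s∈T x∈s in
      transpose-other a b x (λ x≡a → a∉T (subst (_∈ letters T) x≡a x∈T))
                            (λ x≡b → b∉T (subst (_∈ letters T) x≡b x∈T))

missing-letter : ∀ {d} (l : List (Fin d)) → length l < d → ∃ λ a → a ∉ l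
missing-letter {d} l short = FinP.¬∀⟶∃¬ d (_∈ l) (λ a → DecMembership._∈?_ FinP._≟_ a l) not-all-listed
  where
    not-all-listed : ¬ (∀ a → a ∈ l)
    not-all-listed listed with FinP.pigeonhole short (λ a → Any.index (listed a))
    ... | i , j , i<j , same-index = ℕP.<-irrefl (cong toℕ i≡j) i<j
      where
        i≡j : i ≡ j
        i≡j = trans (AnyP.lookup-index (listed i))
                (trans (cong (List.lookup l) same-index) (sym (AnyP.lookup-index (listed j))))

two-missing-letters : ∀ {d} (l : List (Fin d)) → 2 + length l ≤ d → ∃₂ λ a b → a ≢ b × a ∉ l × b ∉ l
two-missing-letters l room with missing-letter l (ℕP.≤-trans (ℕP.n≤1+n _) room)
... | a , a∉l with missing-letter (a List.∷ l) room
...   | b , b∉al = a , b , (λ a≡b → b∉al (here (sym a≡b))) , a∉l , b∉al ∘ there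

-- A determining set uses all letters but at most one, so d-1 ≤ n·|T|.
determining⇒letter-count : ∀ {d' m} (T : List (Vertex (suc d') (suc m))) →
  IsDeterminingSet (suc d') (suc m) T → d' ≤ length T * suc m
determining⇒letter-count {d'} {m} T determining with d' ℕP.≤? length T * suc m
... | yes enough = enough
... | no  few with two-missing-letters (letters T) room
  where
    room : 2 + length (letters T) ≤ suc d'
    room = subst (λ t → 2 + t ≤ suc d') (sym (length-letters T)) (s≤s (ℕP.≰⇒> few))
...   | a , b , a≢b , a∉T , b∉T = ⊥-elim (determining⇒no-two-missing T determining a b a≢b a∉T b∉T)

ceil-least : ∀ a t m → a ≤ t * suc m → ⌈ a / suc m ⌉ ≤ t
ceil-least a t m a≤tn = s≤s⁻¹ (m<n*o⇒m/o<n a+m<[1+t]n)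
  where
    a+m<[1+t]n : a + m < suc t * suc m
    a+m<[1+t]n = s≤s (subst (_≤ m + t * suc m) (ℕP.+-comm m a) (ℕP.+-monoʳ-≤ m a≤tn))

ceil-above : ∀ x a m → x < a → x / suc m < ⌈ a / suc m ⌉
ceil-above x a m x<a = subst (_≤ ⌈ a / suc m ⌉) next-block (/-monoˡ-≤ (suc m) x+n≤a+m)
  where
    x+n≤a+m : x + suc m ≤ a + m
    x+n≤a+m = subst (_≤ a + m) (sym (ℕP.+-suc x m)) (ℕP.+-monoˡ-≤ m x<a)
    next-block : (x + suc m) / suc m ≡ suc (x / suc m)
    next-block = trans (m/n≡1+[m∸n]/n (ℕP.m≤n+m (suc m) x))
                       (cong (λ y → suc (y / suc m)) (ℕP.m+n∸n≡m x (suc m)))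

module Blocks (d' m : ℕ) where

  d n : ℕ
  d = suc d'
  n = suc m

  block : ℕ → Vertex d n
  block j = tabulate λ i → (toℕ i + j * n) mod d

  blocks : ℕ → List (Vertex d n)
  blocks k = List.map block (upTo k)

  length-blocks : ∀ k → length (blocks k) ≡ k
  length-blocks k = trans (ListP.length-map block (upTo k)) (ListP.length-upTo k)

  letter-mod : ∀ (c : Fin d) x → x ≡ toℕ c → x mod d ≡ c
  letter-mod c x x≡c = FinP.toℕ-injective (begin
    toℕ (x mod d) ≡⟨ FinP.toℕ-fromℕ< _ ⟩
    x % d         ≡⟨ m<n⇒m%n≡m (subst (_< d) (sym x≡c) (FinP.toℕ<n c)) ⟩
    x             ≡⟨ x≡c ⟩
    toℕ c         ∎)

  -- The letter c < d-1 is at position (c mod n) of block ⌊c/n⌋.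
  blocks-cover : ∀ c → toℕ c < d' → c ∈ letters (blocks ⌈ d' / n ⌉)
  blocks-cover c c<d' = ∈-letters⁺ (∈P.∈-map⁺ block (∈P.∈-upTo⁺ (ceil-above (toℕ c) d' m c<d'))) c∈block
    where
      open DivMod (toℕ c divMod n) using (quotient; remainder; property)
      c∈block : c ∈ toList (block quotient)
      c∈block = subst (_∈ toList (block quotient))
        (trans (lookup∘tabulate (λ i → (toℕ i + quotient * n) mod d) remainder) (letter-mod c _ (sym property)))
        (∈-toList⁺ (∈-lookup remainder (block quotient)))

  below-last : ∀ (c : Fin d) → c ≢ fromℕ d' → toℕ c < d'
  below-last c c≢last = ℕP.≤∧≢⇒< (s≤s⁻¹ (FinP.toℕ<n c))
    (λ c≡d' → c≢last (FinP.toℕ-injective (trans c≡d' (sym (FinP.toℕ-fromℕ d')))))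

corollary4p13 : (d n : ℕ) → .{{_ : NonZero d}} → .{{_ : NonZero n}} →
    DetIs d n ⌈ d ∸ 1 / n ⌉
corollary4p13 (suc d') (suc m) =
  (blocks k , blocks-determining , length-blocks k) , minimal
  where
    open Blocks d' m
    k : ℕ
    k = ⌈ d' / n ⌉
    blocks-determining : IsDeterminingSet d n (blocks k)
    blocks-determining = all-but-one-letter⇒determining (blocks k) (fromℕ d')
      λ c c≢last → blocks-cover c (below-last c c≢last)
    minimal : ∀ T → IsDeterminingSet d n T → k ≤ length T
    minimal T determining = ceil-least d' (length T) m (determining⇒letter-count T determining)
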